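{- If $e$ is a closed expression with $\cdot\vdash e:\forall\alpha.\,\alpha\multimap\alpha\multimap\alpha\otimes\alpha$ in the linear type system, then $e$ is extensionally equal to $\lambda x.\lambda y.(x,y)$ or to $\lambda x.\lambda y.(y,x)$ (extensional equality of $e$ with a closed term $g$ meaning that for all closed values $v,w$, $e\,v\,w$ and $g\,v\,w$ evaluate to the same value).
   Context: Untyped expressions: $e ::= x \mid (e_1,e_2) \mid \mathbf{match}\; e\; ((x,y)\Rightarrow e') \mid \lambda x.\,e \mid e_1\,e_2$ (application left-associative). Values are $\lambda x.\,e$ and pairs of values. Call-by-value big-step evaluation $e\hookrightarrow v$: $\lambda x.e \hookrightarrow \lambda x.e$; $e_1\,e_2\hookrightarrow v$ if $e_1\hookrightarrow\lambda x.e_1'$, $e_2\hookrightarrow v_2$, $[v_2/x]e_1'\hookrightarrow v$; $(e_1,e_2)\hookrightarrow(v_1,v_2)$ if $e_i\hookrightarrow v_i$; $\mathbf{match}\;e\;((x,y)\Rightarrow e')\hookrightarrow v'$ if $e\hookrightarrow(v_1,v_2)$ and $[v_1/x,v_2/y]e'\hookrightarrow v'$. Linear types: $A,B ::= \alpha \mid A\multimap B \mid A\otimes B \mid \forall\alpha.A$ ($\multimap$ right-associative, binding weaker than $\otimes$). Linear typing $\Delta\mid\Omega\vdash e:A$ ($\Delta$ type variables, $\Omega$ a list of distinct typed variables, juxtaposition = concatenation): (hyp) $\Delta\mid x:A\vdash x:A$; ($\multimap$I) from $\Delta\mid\Omega\,(x:A)\vdash e:B$ infer $\Delta\mid\Omega\vdash\lambda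 x.e:A\multimap B$; ($\multimap$E) from $\Delta\mid\Omega\vdash e_1:A\multimap B$ and $\Delta\mid\Omega_A\vdash e_2:A$ infer $\Delta\mid\Omega\,\Omega_A\vdash e_1e_2:B$; ($\otimes$I) from $\Delta\mid\Omega_A\vdash e_1:A$ and $\Delta\mid\Omega_B\vdash e_2:B$ infer $\Delta\mid\Omega_A\,\Omega_B\vdash(e_1,e_2):A\otimes B$; ($\otimes$E) from $\Delta\mid\Omega\vdash e:A\otimes B$ and $\Delta\mid\Omega_L(x:A)(y:B)\Omega_R\vdash e':C$ infer $\Delta\mid\Omega_L\,\Omega\,\Omega_R\vdash\mathbf{match}\;e\;((x,y)\Rightarrow e'):C$; ($\forall$I) from $\Delta,\alpha\mid\Omega\vdash e:A$ infer $\Delta\mid\Omega\vdash e:\forall\alpha.A$; ($\forall$E) from $\Delta\mid\Omega\vdash e:\forall\alpha.A(\alpha)$ and $B$ a type over $\Delta$ infer $\Delta\mid\Omega\vdash e:A(B)$; (exchange) from $\Delta\mid\Omega_L\,(y:B)\,(x:A)\,\Omega_R\vdash e:C$ infer $\Delta\mid\Omega_L\,(x:A)\,(y:B)\,\Omega_R\vdash e:C$. $\cdot\vdash e:A$ means $\cdot\mid\cdot\vdash e:A$. -}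

module Defs where

open import Data.Nat using (ℕ; zero; suc; _≟_)
open import Data.Fin using (Fin; zero; suc)
open import Data.List using (List; []; _∷_; _++_; map)
open import Data.List.Membership.Propositional using (_∈_; _∉_)
open import Data.List.Relation.Unary.Unique.Propositional using (Unique)
open import Data.Product using (Σ; _×_; _,_; proj₁)
open import Relation.Nullary using (yes; no)

Var : Set
Var = ℕ

data Exp : Set where
  var  : Var → Exp
  pair : Exp → Exp → Exp
  mtch : Exp → Var → Var → Exp → Exp      -- match e ((x,y) ⇒ e')
  lam  : Var → Exp → Exp
  app  : Exp → Exp → Exp

data Value : Exp → Set where
  v-lam  : ∀ x e → Value (lam x e)
  v-pair : ∀ {v₁ v₂} → Value v₁ → Value v₂ → Value (pair v₁ v₂)

data ClosedIn (bs : List Var) : Exp → Set where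
  c-var  : ∀ {x} → x ∈ bs → ClosedIn bs (var x)
  c-pair : ∀ {e₁ e₂} → ClosedIn bs e₁ → ClosedIn bs e₂ → ClosedIn bs (pair e₁ e₂)
  c-mtch : ∀ {e x y e'} → ClosedIn bs e → ClosedIn (x ∷ y ∷ bs) e' →
           ClosedIn bs (mtch e x y e')
  c-lam  : ∀ {x e} → ClosedIn (x ∷ bs) e → ClosedIn bs (lam x e)
  c-app  : ∀ {e₁ e₂} → ClosedIn bs e₁ → ClosedIn bs e₂ → ClosedIn bs (app e₁ e₂)

Closed : Exp → Set
Closed = ClosedIn []

-- Simultaneous substitution [v₁/x₁, …]e (only ever used with closed
-- values in evaluation of closed terms, so no capture can occur).

Sub : Set
Sub = List (Var × Exp)

lookupSub : Sub → Var → Exp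
lookupSub []             z = var z
lookupSub ((x , v) ∷ σ) z with x ≟ z
... | yes _ = v
... | no  _ = lookupSub σ z

remove : Var → Sub → Sub
remove z [] = []
remove z ((x , v) ∷ σ) with x ≟ z
... | yes _ = remove z σ
... | no  _ = (x , v) ∷ remove z σ

subst : Sub → Exp → Exp
subst σ (var z)        = lookupSub σ z
subst σ (pair e₁ e₂)   = pair (subst σ e₁) (subst σ e₂)
subst σ (mtch e x y e') = mtch (subst σ e) x y (subst (remove y (remove x σ)) e')
subst σ (lam x e)      = lam x (subst (remove x σ) e)
subst σ (app e₁ e₂)    = app (subst σ e₁) (subst σ e₂)

infix 4 _↪_
data _↪_ : Exp → Exp → Set where
  ev-lam  : ∀ {x e} → lam x e ↪ lam x e
  ev-app  : ∀ {e₁ e₂ x e₁' v₂ v} →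
            e₁ ↪ lam x e₁' → e₂ ↪ v₂ → subst ((x , v₂) ∷ []) e₁' ↪ v →
            app e₁ e₂ ↪ v
  ev-pair : ∀ {e₁ e₂ v₁ v₂} → e₁ ↪ v₁ → e₂ ↪ v₂ → pair e₁ e₂ ↪ pair v₁ v₂
  ev-mtch : ∀ {e x y e' v₁ v₂ v'} →
            e ↪ pair v₁ v₂ → subst ((x , v₁) ∷ (y , v₂) ∷ []) e' ↪ v' →
            mtch e x y e' ↪ v'

-- Linear types, type variables in de Bruijn form (Ty n: n type vars in Δ)

infixr 5 _⊸_
infixr 6 _⊗_
data Ty (n : ℕ) : Set where
  tv   : Fin n → Ty n
  _⊸_  : Ty n → Ty n → Ty n
  _⊗_  : Ty n → Ty n → Ty n
  all  : Ty (suc n) → Ty n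

ext : ∀ {n m} → (Fin n → Fin m) → Fin (suc n) → Fin (suc m)
ext ρ zero    = zero
ext ρ (suc i) = suc (ρ i)

ren : ∀ {n m} → (Fin n → Fin m) → Ty n → Ty m
ren ρ (tv i)  = tv (ρ i)
ren ρ (A ⊸ B) = ren ρ A ⊸ ren ρ B
ren ρ (A ⊗ B) = ren ρ A ⊗ ren ρ B
ren ρ (all A) = all (ren (ext ρ) A)

exts : ∀ {n m} → (Fin n → Ty m) → Fin (suc n) → Ty (suc m)
exts σ zero    = tv zero
exts σ (suc i) = ren suc (σ i)

tsub : ∀ {n m} → (Fin n → Ty m) → Ty n → Ty m
tsub σ (tv i)  = σ i
tsub σ (A ⊸ B) = tsub σ A ⊸ tsub σ B
tsub σ (A ⊗ B) = tsub σ A ⊗ tsub σ B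
tsub σ (all A) = all (tsub (exts σ) A)

inst-σ : ∀ {n} → Ty n → Fin (suc n) → Ty n
inst-σ B zero    = B
inst-σ B (suc i) = tv i

infixl 8 _[_]ᵗ
_[_]ᵗ : ∀ {n} → Ty (suc n) → Ty n → Ty n
A [ B ]ᵗ = tsub (inst-σ B) A

Ctx : ℕ → Set
Ctx n = List (Var × Ty n)

Distinct : ∀ {n} → Ctx n → Set
Distinct Ω = Unique (map proj₁ Ω)

wkCtx : ∀ {n} → Ctx n → Ctx (suc n)
wkCtx = map (λ { (x , A) → (x , ren suc A) })

-- Every rule whose conclusion context is a concatenation requires that
-- context to consist of distinct variables, so all derivable judgments
-- have distinct contexts.
infix 3 _⊢_∶_
data _⊢_∶_ {n : ℕ} : Ctx n → Exp → Ty n → Set where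
  hyp  : ∀ {x A} → ((x , A) ∷ []) ⊢ var x ∶ A
  ⊸I   : ∀ {Ω x e A B} → (Ω ++ (x , A) ∷ []) ⊢ e ∶ B → Ω ⊢ lam x e ∶ A ⊸ B
  ⊸E   : ∀ {Ω ΩA e₁ e₂ A B} → Distinct (Ω ++ ΩA) →
         Ω ⊢ e₁ ∶ A ⊸ B → ΩA ⊢ e₂ ∶ A → (Ω ++ ΩA) ⊢ app e₁ e₂ ∶ B
  ⊗I   : ∀ {ΩA ΩB e₁ e₂ A B} → Distinct (ΩA ++ ΩB) →
         ΩA ⊢ e₁ ∶ A → ΩB ⊢ e₂ ∶ B → (ΩA ++ ΩB) ⊢ pair e₁ e₂ ∶ A ⊗ B
  ⊗E   : ∀ {Ω ΩL ΩR e x y e' A B C} → Distinct (ΩL ++ Ω ++ ΩR) →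
         Ω ⊢ e ∶ A ⊗ B → (ΩL ++ (x , A) ∷ (y , B) ∷ ΩR) ⊢ e' ∶ C →
         (ΩL ++ Ω ++ ΩR) ⊢ mtch e x y e' ∶ C
  ∀I   : ∀ {Ω e A} → _⊢_∶_ {suc n} (wkCtx Ω) e A → Ω ⊢ e ∶ all A
  ∀E   : ∀ {Ω e A} (B : Ty n) → Ω ⊢ e ∶ all A → Ω ⊢ e ∶ A [ B ]ᵗ
  exch : ∀ {ΩL ΩR x y A B e C} →
         (ΩL ++ (y , B) ∷ (x , A) ∷ ΩR) ⊢ e ∶ C →
         (ΩL ++ (x , A) ∷ (y , B) ∷ ΩR) ⊢ e ∶ C

infix 3 ⊢₀_∶_
⊢₀_∶_ : Exp → Ty 0 → Set
⊢₀ e ∶ A = _⊢_∶_ {0} [] e A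

ExtEq : Exp → Exp → Set
ExtEq e g = ∀ v w → Value v → Closed v → Value w → Closed w →
            Σ Exp (λ u → (app (app e v) w ↪ u) × (app (app g v) w ↪ u))

swapTy : Ty 0
swapTy = all (tv zero ⊸ tv zero ⊸ tv zero ⊗ tv zero)

idPair swPair : Exp
idPair = lam 0 (lam 1 (pair (var 0) (var 1)))
swPair = lam 0 (lam 1 (pair (var 1) (var 0)))

-- Run e on two opaque tokens ⋆₁ ⋆₂ in place of its arguments. In an auxiliary linear type
-- system for expressions with tokens, where each token is a resource of type α, this run has
-- type α ⊗ α in the context ⋆₁ ⋆₂. Linear substitution preserves typing and shrinks the term,
-- so the run evaluates, and a value of type α ⊗ α that uses each token exactly once is
-- (⋆₁ , ⋆₂) or (⋆₂ , ⋆₁). Evaluation never inspects a token, so replacing the tokens by closed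
-- values v and w turns this run into an evaluation of e v w to (v , w) or (w , v).
module Submission where

open import Algebra.Bundles using (CommutativeMonoid)
import Algebra.Properties.CommutativeSemigroup as CommutativeSemigroupProperties
open import Data.Bool using (Bool; true; false; not; if_then_else_)
open import Data.Empty using (⊥; ⊥-elim)
open import Data.Fin using (Fin; zero; suc)
open import Data.List using (List; []; _∷_; _++_; _∷ʳ_; map)
import Data.List.Properties as List
open import Data.List.Membership.Propositional using (_∈_; _∉_)
open import Data.List.Membership.Propositional.Properties using (∈-++⁻; ∈-∃++)
open import Data.List.Relation.Binary.Permutation.Propositional
  using (_↭_; prep; swap; ↭-refl; ↭-reflexive; ↭-sym; ↭-trans; ↭⇒↭ₛ)
import Data.List.Relation.Binary.Permutation.Propositional.Properties as ↭
import Data.List.Relation.Binary.Permutation.Setoid.Properties as ↭ₛ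
open import Data.List.Relation.Unary.All as All using (All; []; _∷_)
import Data.List.Relation.Unary.All.Properties as Allₚ
open import Data.List.Relation.Unary.AllPairs using ([]; _∷_)
open import Data.List.Relation.Unary.Any using (here; there)
open import Data.List.Relation.Unary.Unique.Propositional using (Unique)
open import Data.Nat using (ℕ; zero; suc; _+_; _≤_; s≤s; _≟_)
open import Data.Nat.Properties
  using (+-assoc; +-comm; +-mono-≤; ≤-refl; ≤-trans; ≤-reflexive; <⇒≤; n≤1+n; m≤n⇒m≤1+n;
         m+n≤o⇒m≤o; m+n≤o⇒n≤o; +-commutativeSemigroup; module ≤-Reasoning)
open import Data.Product as Product using (∃; ∃₂; _×_; _,_; proj₁; proj₂)
open import Data.Sum using (_⊎_; inj₁; inj₂)
open import Data.Unit using (⊤)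
open import Data.Vec.Functional using () renaming (_∷_ to _∷ᵛ_)
open import Function using (_∘_)
open import Relation.Binary.PropositionalEquality as ≡
  using (_≡_; _≢_; refl; sym; trans; cong; cong₂; ≢-sym)
open import Relation.Nullary using (yes; no)

open import Defs

open CommutativeSemigroupProperties +-commutativeSemigroup using (xy∙z≈xz∙y)

private
  variable
    n : ℕ
    x y z : Var
    a b : Bool
    e : Exp
    Ω Ω′ : Ctx n
    D : Ty n

value-↪ : ∀ {v} → Value v → v ↪ v
value-↪ (v-lam _ _)    = ev-lam
value-↪ (v-pair v₁ v₂) = ev-pair (value-↪ v₁) (value-↪ v₂)

lookupSub-miss : ∀ {σ} → All (λ (y , _) → y ≢ z) σ → lookupSub σ z ≡ var z
lookupSub-miss {σ = []} [] = refl
lookupSub-miss {z} {σ = (y , _) ∷ _} (y≢z ∷ σ≢z) with y ≟ z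
... | yes y≡z = ⊥-elim (y≢z y≡z)
... | no  _   = lookupSub-miss σ≢z

remove-All : ∀ {P : Var × Exp → Set} σ → All P σ → All (λ p → P p × proj₁ p ≢ z) (remove z σ)
remove-All [] [] = []
remove-All {z} ((y , _) ∷ σ) (p ∷ ps) with y ≟ z
... | yes _   = remove-All σ ps
... | no  y≢z = (p , y≢z) ∷ remove-All σ ps

∉-∷ : ∀ {bs} → y ≢ x → y ∉ bs → y ∉ x ∷ bs
∉-∷ y≢x _    (here y≡x)   = y≢x y≡x
∉-∷ _   y∉bs (there y∈bs) = y∉bs y∈bs

subst-closed : ∀ {bs v} → ClosedIn bs v → ∀ σ → All (λ (y , _) → y ∉ bs) σ → subst σ v ≡ v
subst-closed (c-var x∈bs) σ fresh =
  lookupSub-miss (All.map (λ y∉bs y≡x → y∉bs (≡.subst (_∈ _) (sym y≡x) x∈bs)) fresh)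
subst-closed (c-pair c₁ c₂) σ fresh = cong₂ pair (subst-closed c₁ σ fresh) (subst-closed c₂ σ fresh)
subst-closed (c-mtch {x = x} {y = y} c c′) σ fresh =
  cong₂ (λ s t → mtch s x y t) (subst-closed c σ fresh)
    (subst-closed c′ _ (All.map (λ ((∉bs , ≢x) , ≢y) → ∉-∷ ≢x (∉-∷ ≢y ∉bs))
                                (remove-All _ (remove-All σ fresh))))
subst-closed (c-lam {x} c) σ fresh =
  cong (lam x) (subst-closed c _ (All.map (λ (∉bs , ≢x) → ∉-∷ ≢x ∉bs) (remove-All σ fresh)))
subst-closed (c-app c₁ c₂) σ fresh = cong₂ app (subst-closed c₁ σ fresh) (subst-closed c₂ σ fresh)

subst-closed₀ : ∀ {v} → Closed v → ∀ σ → subst σ v ≡ v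
subst-closed₀ c σ = subst-closed c σ (All.universal (λ _ ()) σ)

++-↭-∷⁻ : ∀ {A : Set} (xs : List A) {ys zs w} → xs ++ ys ↭ w ∷ zs →
          (∃ λ xs′ → xs ↭ w ∷ xs′ × xs′ ++ ys ↭ zs) ⊎ (∃ λ ys′ → ys ↭ w ∷ ys′ × xs ++ ys′ ↭ zs)
++-↭-∷⁻ xs {ys} {w = w} p with ∈-++⁻ xs (↭.∈-resp-↭ (↭-sym p) (here refl))
... | inj₁ w∈xs with h , t , refl ← ∈-∃++ w∈xs =
  inj₁ (h ++ t , ↭.shift w h t , ↭.drop-∷ (↭-trans (↭-sym (↭.++⁺ʳ ys (↭.shift w h t))) p))
... | inj₂ w∈ys with h , t , refl ← ∈-∃++ w∈ys =
  inj₂ (h ++ t , ↭.shift w h t , ↭.drop-∷ (↭-trans (↭-sym w-to-front) p))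
  where w-to-front = ↭-trans (↭.++⁺ˡ xs (↭.shift w h t)) (↭.shift w xs (h ++ t))

-- Type substitution

ren-ren : ∀ {n m k} {ρ₁ : Fin n → Fin m} {ρ₂ : Fin m → Fin k} {ρ : Fin n → Fin k} →
          (∀ i → ρ₂ (ρ₁ i) ≡ ρ i) → ∀ A → ren ρ₂ (ren ρ₁ A) ≡ ren ρ A
ren-ren h (tv i)  = cong tv (h i)
ren-ren h (A ⊸ B) = cong₂ _⊸_ (ren-ren h A) (ren-ren h B)
ren-ren h (A ⊗ B) = cong₂ _⊗_ (ren-ren h A) (ren-ren h B)
ren-ren h (all A) = cong all (ren-ren (λ { zero → refl ; (suc i) → cong suc (h i) }) A)

tsub-ren : ∀ {n m k} {ρ : Fin n → Fin m} {τ : Fin m → Ty k} {σ : Fin n → Ty k} →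
           (∀ i → τ (ρ i) ≡ σ i) → ∀ A → tsub τ (ren ρ A) ≡ tsub σ A
tsub-ren h (tv i)  = h i
tsub-ren h (A ⊸ B) = cong₂ _⊸_ (tsub-ren h A) (tsub-ren h B)
tsub-ren h (A ⊗ B) = cong₂ _⊗_ (tsub-ren h A) (tsub-ren h B)
tsub-ren h (all A) = cong all (tsub-ren (λ { zero → refl ; (suc i) → cong (ren suc) (h i) }) A)

ren-tsub : ∀ {n m k} {σ : Fin n → Ty m} {ρ : Fin m → Fin k} {τ : Fin n → Ty k} →
           (∀ i → ren ρ (σ i) ≡ τ i) → ∀ A → ren ρ (tsub σ A) ≡ tsub τ A
ren-tsub h (tv i)  = h i
ren-tsub h (A ⊸ B) = cong₂ _⊸_ (ren-tsub h A) (ren-tsub h B)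
ren-tsub h (A ⊗ B) = cong₂ _⊗_ (ren-tsub h A) (ren-tsub h B)
ren-tsub {σ = σ} h (all A) = cong all (ren-tsub exts-h A)
  where
    exts-h : ∀ i → ren (ext _) (exts σ i) ≡ exts _ i
    exts-h zero    = refl
    exts-h (suc i) = trans (ren-ren (λ _ → refl) (σ i))
                       (trans (sym (ren-ren (λ _ → refl) (σ i))) (cong (ren suc) (h i)))

tsub-tsub : ∀ {n m k} {σ : Fin n → Ty m} {τ : Fin m → Ty k} {ρ : Fin n → Ty k} →
            (∀ i → tsub τ (σ i) ≡ ρ i) → ∀ A → tsub τ (tsub σ A) ≡ tsub ρ A
tsub-tsub h (tv i)  = h i
tsub-tsub h (A ⊸ B) = cong₂ _⊸_ (tsub-tsub h A) (tsub-tsub h B)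
tsub-tsub h (A ⊗ B) = cong₂ _⊗_ (tsub-tsub h A) (tsub-tsub h B)
tsub-tsub {σ = σ} h (all A) = cong all (tsub-tsub exts-h A)
  where
    exts-h : ∀ i → tsub (exts _) (exts σ i) ≡ exts _ i
    exts-h zero    = refl
    exts-h (suc i) = trans (tsub-ren (λ _ → refl) (σ i))
                       (trans (sym (ren-tsub (λ _ → refl) (σ i))) (cong (ren suc) (h i)))

tsub-id : ∀ {n} {σ : Fin n → Ty n} → (∀ i → σ i ≡ tv i) → ∀ A → tsub σ A ≡ A
tsub-id h (tv i)  = h i
tsub-id h (A ⊸ B) = cong₂ _⊸_ (tsub-id h A) (tsub-id h B)
tsub-id h (A ⊗ B) = cong₂ _⊗_ (tsub-id h A) (tsub-id h B)
tsub-id h (all A) = cong all (tsub-id (λ { zero → refl ; (suc i) → cong (ren suc) (h i) }) A)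

inst-exts : ∀ {n m} (C : Ty m) (σ : Fin n → Ty m) A → tsub (exts σ) A [ C ]ᵗ ≡ tsub (C ∷ᵛ σ) A
inst-exts C σ = tsub-tsub λ
  { zero    → refl
  ; (suc i) → trans (tsub-ren (λ _ → refl) (σ i)) (tsub-id (λ _ → refl) (σ i)) }

tsub-inst : ∀ {n m} (σ : Fin n → Ty m) B A → tsub σ (A [ B ]ᵗ) ≡ tsub (tsub σ B ∷ᵛ σ) A
tsub-inst σ B = tsub-tsub λ { zero → refl ; (suc i) → refl }

-- Expressions with tokens

data Tm : Set where
  var  : Var → Tm
  tok  : Bool → Tm
  pair : Tm → Tm → Tm
  mtch : Tm → Var → Var → Tm → Tm
  lam  : Var → Tm → Tm
  app  : Tm → Tm → Tm

private
  variable
    s s₁ s₂ t u v v₁ v₂ : Tm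

embed : Exp → Tm
embed (var x)         = var x
embed (pair e₁ e₂)    = pair (embed e₁) (embed e₂)
embed (mtch e x y e′) = mtch (embed e) x y (embed e′)
embed (lam x e)       = lam x (embed e)
embed (app e₁ e₂)     = app (embed e₁) (embed e₂)

TmSub : Set
TmSub = List (Var × Tm)

lookupTm : TmSub → Var → Tm
lookupTm []            z = var z
lookupTm ((x , u) ∷ σ) z with x ≟ z
... | yes _ = u
... | no  _ = lookupTm σ z

removeTm : Var → TmSub → TmSub
removeTm z [] = []
removeTm z ((x , u) ∷ σ) with x ≟ z
... | yes _ = removeTm z σ
... | no  _ = (x , u) ∷ removeTm z σ

substTm : TmSub → Tm → Tm
substTm σ (var z)        = lookupTm σ z
substTm σ (tok a)        = tok a
substTm σ (pair s₁ s₂)   = pair (substTm σ s₁) (substTm σ s₂)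
substTm σ (mtch s x y t) = mtch (substTm σ s) x y (substTm (removeTm y (removeTm x σ)) t)
substTm σ (lam x t)      = lam x (substTm (removeTm x σ) t)
substTm σ (app s₁ s₂)    = app (substTm σ s₁) (substTm σ s₂)

infixl 8 _[_≔_]
_[_≔_] : Tm → Var → Tm → Tm
t [ x ≔ u ] = substTm ((x , u) ∷ []) t

-- Atoms weigh nothing, so substituting u for a variable that occurs once adds exactly size u.
-- A match weighs as much as app s (lam x (lam y t)), the shape in which ⊗E below types it.
size : Tm → ℕ
size (var _)        = 0
size (tok _)        = 0
size (pair s₁ s₂)   = suc (size s₁ + size s₂)
size (mtch s _ _ t) = suc (size s + suc (suc (size t)))
size (lam _ t)      = suc (size t)
size (app s₁ s₂)    = suc (size s₁ + size s₂)

data TmValue : Tm → Set where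
  v-tok  : ∀ a → TmValue (tok a)
  v-lam  : ∀ x t → TmValue (lam x t)
  v-pair : TmValue v₁ → TmValue v₂ → TmValue (pair v₁ v₂)

infix 4 _⇓_
data _⇓_ : Tm → Tm → Set where
  ev-tok  : tok a ⇓ tok a
  ev-lam  : lam x t ⇓ lam x t
  ev-app  : s₁ ⇓ lam x t → s₂ ⇓ u → t [ x ≔ u ] ⇓ v → app s₁ s₂ ⇓ v
  ev-pair : s₁ ⇓ v₁ → s₂ ⇓ v₂ → pair s₁ s₂ ⇓ pair v₁ v₂
  ev-mtch : s ⇓ pair v₁ v₂ → substTm ((x , v₁) ∷ (y , v₂) ∷ []) t ⇓ v → mtch s x y t ⇓ v

⇓-value : s ⇓ v → TmValue v
⇓-value ev-tok            = v-tok _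
⇓-value ev-lam            = v-lam _ _
⇓-value (ev-app _ _ ⇓v)   = ⇓-value ⇓v
⇓-value (ev-pair ⇓v₁ ⇓v₂) = v-pair (⇓-value ⇓v₁) (⇓-value ⇓v₂)
⇓-value (ev-mtch _ ⇓v)    = ⇓-value ⇓v

lookupTm-hit : ∀ x u σ → lookupTm ((x , u) ∷ σ) x ≡ u
lookupTm-hit x u σ with x ≟ x
... | yes _   = refl
... | no  x≢x = ⊥-elim (x≢x refl)

lookupTm-miss : ∀ {σ} → All (λ (y , _) → y ≢ z) σ → lookupTm σ z ≡ var z
lookupTm-miss {σ = []} [] = refl
lookupTm-miss {z} {σ = (y , _) ∷ _} (y≢z ∷ σ≢z) with y ≟ z
... | yes y≡z = ⊥-elim (y≢z y≡z)
... | no  _   = lookupTm-miss σ≢z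

removeTm-miss : x ≢ z → removeTm z ((x , u) ∷ []) ≡ (x , u) ∷ []
removeTm-miss {x} {z} x≢z with x ≟ z
... | yes x≡z = ⊥-elim (x≢z x≡z)
... | no  _   = refl

removeTm-All : ∀ {P : Var × Tm → Set} σ → All P σ → All (λ p → P p × proj₁ p ≢ z) (removeTm z σ)
removeTm-All [] [] = []
removeTm-All {z} ((y , _) ∷ σ) (p ∷ ps) with y ≟ z
... | yes _   = removeTm-All σ ps
... | no  y≢z = (p , y≢z) ∷ removeTm-All σ ps

substTm-[] : ∀ t → substTm [] t ≡ t
substTm-[] (var x)        = refl
substTm-[] (tok a)        = refl
substTm-[] (pair s₁ s₂)   = cong₂ pair (substTm-[] s₁) (substTm-[] s₂)
substTm-[] (mtch s x y t) = cong₂ (λ s t → mtch s x y t) (substTm-[] s) (substTm-[] t)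
substTm-[] (lam x t)      = cong (lam x) (substTm-[] t)
substTm-[] (app s₁ s₂)    = cong₂ app (substTm-[] s₁) (substTm-[] s₂)

substTm-∷ : (∀ σ → substTm σ v ≡ v) → ∀ σ t → substTm ((x , v) ∷ σ) t ≡ substTm σ (t [ x ≔ v ])
substTm-∷ {x = x} inv σ (var z) with x ≟ z
... | yes _ = sym (inv σ)
... | no  _ = refl
substTm-∷ inv σ (tok a) = refl
substTm-∷ inv σ (pair s₁ s₂) = cong₂ pair (substTm-∷ inv σ s₁) (substTm-∷ inv σ s₂)
substTm-∷ {x = x} inv σ (mtch s y₁ y₂ t) with x ≟ y₁
... | yes _ = cong₂ (λ s t → mtch s y₁ y₂ t) (substTm-∷ inv σ s)
                    (cong (substTm _) (sym (substTm-[] t)))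
... | no  _ with x ≟ y₂
...   | yes _ = cong₂ (λ s t → mtch s y₁ y₂ t) (substTm-∷ inv σ s)
                      (cong (substTm _) (sym (substTm-[] t)))
...   | no  _ = cong₂ (λ s t → mtch s y₁ y₂ t) (substTm-∷ inv σ s) (substTm-∷ inv _ t)
substTm-∷ {x = x} inv σ (lam y t) with x ≟ y
... | yes _ = cong (lam y) (cong (substTm _) (sym (substTm-[] t)))
... | no  _ = cong (lam y) (substTm-∷ inv _ t)
substTm-∷ inv σ (app s₁ s₂) = cong₂ app (substTm-∷ inv σ s₁) (substTm-∷ inv σ s₂)

-- Filling the tokens

module Filling (f : Bool → Exp) (f-closed : ∀ a → Closed (f a)) (f-value : ∀ a → Value (f a)) where

  fill : Tm → Exp
  fill (var x)        = var x
  fill (tok a)        = f a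
  fill (pair s₁ s₂)   = pair (fill s₁) (fill s₂)
  fill (mtch s x y t) = mtch (fill s) x y (fill t)
  fill (lam x t)      = lam x (fill t)
  fill (app s₁ s₂)    = app (fill s₁) (fill s₂)

  fillSub : TmSub → Sub
  fillSub = map (Product.map₂ fill)

  fill-lookupTm : ∀ σ z → fill (lookupTm σ z) ≡ lookupSub (fillSub σ) z
  fill-lookupTm []            z = refl
  fill-lookupTm ((x , u) ∷ σ) z with x ≟ z
  ... | yes _ = refl
  ... | no  _ = fill-lookupTm σ z

  fill-removeTm : ∀ z σ → fillSub (removeTm z σ) ≡ remove z (fillSub σ)
  fill-removeTm z []            = refl
  fill-removeTm z ((x , u) ∷ σ) with x ≟ z
  ... | yes _ = fill-removeTm z σ
  ... | no  _ = cong ((x , fill u) ∷_) (fill-removeTm z σ)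

  fill-substTm : ∀ σ t → fill (substTm σ t) ≡ subst (fillSub σ) (fill t)
  fill-substTm σ (var z)        = fill-lookupTm σ z
  fill-substTm σ (tok a)        = sym (subst-closed₀ (f-closed a) (fillSub σ))
  fill-substTm σ (pair s₁ s₂)   = cong₂ pair (fill-substTm σ s₁) (fill-substTm σ s₂)
  fill-substTm σ (mtch s x y t) =
    cong₂ (λ s t → mtch s x y t) (fill-substTm σ s)
      (trans (fill-substTm _ t) (cong (λ τ → subst τ (fill t)) fill-removeTm₂))
    where
      fill-removeTm₂ : fillSub (removeTm y (removeTm x σ)) ≡ remove y (remove x (fillSub σ))
      fill-removeTm₂ = trans (fill-removeTm y (removeTm x σ)) (cong (remove y) (fill-removeTm x σ))
  fill-substTm σ (lam x t)      =
    cong (lam x) (trans (fill-substTm _ t) (cong (λ τ → subst τ (fill t)) (fill-removeTm x σ)))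
  fill-substTm σ (app s₁ s₂)    = cong₂ app (fill-substTm σ s₁) (fill-substTm σ s₂)

  fill-⇓ : s ⇓ v → fill s ↪ fill v
  fill-⇓ (ev-tok {a}) = value-↪ (f-value a)
  fill-⇓ ev-lam = ev-lam
  fill-⇓ (ev-app {x = x} {t = t} {u = u} ⇓f ⇓u ⇓v) =
    ev-app (fill-⇓ ⇓f) (fill-⇓ ⇓u) (≡.subst (_↪ _) (fill-substTm ((x , u) ∷ []) t) (fill-⇓ ⇓v))
  fill-⇓ (ev-pair ⇓v₁ ⇓v₂) = ev-pair (fill-⇓ ⇓v₁) (fill-⇓ ⇓v₂)
  fill-⇓ (ev-mtch {v₁ = v₁} {v₂ = v₂} {x = x} {y = y} {t = t} ⇓p ⇓v) =
    ev-mtch (fill-⇓ ⇓p) (≡.subst (_↪ _) (fill-substTm ((x , v₁) ∷ (y , v₂) ∷ []) t) (fill-⇓ ⇓v))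

  fill-embed : ∀ e → fill (embed e) ≡ e
  fill-embed (var x)         = refl
  fill-embed (pair e₁ e₂)    = cong₂ pair (fill-embed e₁) (fill-embed e₂)
  fill-embed (mtch e x y e′) = cong₂ (λ e e′ → mtch e x y e′) (fill-embed e) (fill-embed e′)
  fill-embed (lam x e)       = cong (lam x) (fill-embed e)
  fill-embed (app e₁ e₂)     = cong₂ app (fill-embed e₁) (fill-embed e₂)

-- Linear typing of expressions with tokens

data Key : Set where
  vr : Var → Key
  tk : Bool → Key

Cx : Set
Cx = List (Key × Ty 1)

α : Ty 1
α = tv zero

private
  variable
    A B C T T₁ T₂ : Ty 1
    Γ Γ₁ Γ₂ Δ Ψ : Cx

Fresh : Var → Cx → Set
Fresh x = All (λ (k , _) → vr x ≢ k)

IsTok : Key → Set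
IsTok (vr _) = ⊥
IsTok (tk _) = ⊤

Tokens : Cx → Set
Tokens = All (IsTok ∘ proj₁)

vr-≢ : x ≢ y → vr x ≢ vr y
vr-≢ x≢y refl = x≢y refl

≢-vr : vr x ≢ vr y → x ≢ y
≢-vr vx≢vy = vx≢vy ∘ cong vr

tokens-fresh : Tokens Γ → Fresh x Γ
tokens-fresh = All.map λ { {vr _ , _} () ; {tk _ , _} _ () }

-- Types range over the single variable α of the tokens, and ∀ is read as the conjunction of
-- its instances at all such types (∀I), so derivations never need type substitution. Contexts
-- are taken up to permutation (perm), and ⊗E types the continuation of a match curried.
infix 3 _⊩_∶_
data _⊩_∶_ : Cx → Tm → Ty 1 → Set where
  hyp  : (vr x , A) ∷ [] ⊩ var x ∶ A
  tok  : (tk a , α) ∷ [] ⊩ tok a ∶ α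
  ⊸I   : Fresh x Γ → (vr x , A) ∷ Γ ⊩ t ∶ B → Γ ⊩ lam x t ∶ A ⊸ B
  ⊸E   : Γ ⊩ s₁ ∶ A ⊸ B → Δ ⊩ s₂ ∶ A → Γ ++ Δ ⊩ app s₁ s₂ ∶ B
  ⊗I   : Γ ⊩ s₁ ∶ A → Δ ⊩ s₂ ∶ B → Γ ++ Δ ⊩ pair s₁ s₂ ∶ A ⊗ B
  ⊗E   : Γ ⊩ s ∶ A ⊗ B → Δ ⊩ lam x (lam y t) ∶ A ⊸ B ⊸ C → Γ ++ Δ ⊩ mtch s x y t ∶ C
  ∀I   : ∀ {A} → (∀ C → Γ ⊩ s ∶ A [ C ]ᵗ) → Γ ⊩ s ∶ all A
  ∀E   : ∀ {A} C → Γ ⊩ s ∶ all A → Γ ⊩ s ∶ A [ C ]ᵗ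
  perm : Γ ↭ Δ → Γ ⊩ s ∶ A → Δ ⊩ s ∶ A

curry-⊩ : x ≢ y → Fresh x Γ → Fresh y Γ → (vr x , A) ∷ (vr y , B) ∷ Γ ⊩ t ∶ C →
          Γ ⊩ lam x (lam y t) ∶ A ⊸ B ⊸ C
curry-⊩ x≢y fx fy ⊢t = ⊸I fx (⊸I (vr-≢ (≢-sym x≢y) ∷ fy) (perm (swap _ _ ↭-refl) ⊢t))

data Split (Θ : Cx) (s₁ : Tm) (T₁ : Ty 1) (s₂ : Tm) (T₂ : Ty 1) : Set where
  split : Γ₁ ++ Γ₂ ↭ Θ → Γ₁ ⊩ s₁ ∶ T₁ → Γ₂ ⊩ s₂ ∶ T₂ → Split Θ s₁ T₁ s₂ T₂

module ++-↭ = CommutativeSemigroupProperties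
  (CommutativeMonoid.commutativeSemigroup (↭.++-commutativeMonoid {A = Key × Ty 1}))

substTm-fresh : Γ ⊩ s ∶ T → ∀ σ → All (λ (y , _) → Fresh y Γ) σ → substTm σ s ≡ s
substTm-fresh hyp σ fresh = lookupTm-miss (All.map (λ { (y≢x ∷ []) → ≢-vr y≢x }) fresh)
substTm-fresh tok σ fresh = refl
substTm-fresh (⊸I {x = x} _ ⊢t) σ fresh =
  cong (lam x) (substTm-fresh ⊢t _ (All.map (λ (fy , y≢x) → vr-≢ y≢x ∷ fy) (removeTm-All σ fresh)))
substTm-fresh (⊸E {Γ = Γ} ⊢s₁ ⊢s₂) σ fresh =
  cong₂ app (substTm-fresh ⊢s₁ σ (All.map (Allₚ.++⁻ˡ Γ) fresh))
            (substTm-fresh ⊢s₂ σ (All.map (Allₚ.++⁻ʳ Γ) fresh))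
substTm-fresh (⊗I {Γ = Γ} ⊢s₁ ⊢s₂) σ fresh =
  cong₂ pair (substTm-fresh ⊢s₁ σ (All.map (Allₚ.++⁻ˡ Γ) fresh))
             (substTm-fresh ⊢s₂ σ (All.map (Allₚ.++⁻ʳ Γ) fresh))
substTm-fresh (⊗E {Γ = Γ} {x = x} {y = y} ⊢s ⊢k) σ fresh =
  cong₂ (λ s t → mtch s x y t) (substTm-fresh ⊢s σ (All.map (Allₚ.++⁻ˡ Γ) fresh))
    (lam-lam-injective (substTm-fresh ⊢k σ (All.map (Allₚ.++⁻ʳ Γ) fresh)))
  where
    lam-lam-injective : ∀ {t t′} → lam x (lam y t) ≡ lam x (lam y t′) → t ≡ t′
    lam-lam-injective refl = refl
substTm-fresh (∀I ⊢s) σ fresh = substTm-fresh (⊢s α) σ fresh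
substTm-fresh (∀E _ ⊢s) σ fresh = substTm-fresh ⊢s σ fresh
substTm-fresh (perm p ⊢s) σ fresh = substTm-fresh ⊢s σ (All.map (↭.All-resp-↭ (↭-sym p)) fresh)

substTm-tokens : Γ ⊩ s ∶ T → Tokens Γ → ∀ σ → substTm σ s ≡ s
substTm-tokens ⊢s ts σ = substTm-fresh ⊢s σ (All.universal (λ _ → tokens-fresh ts) σ)

-- Linear substitution

module _ {x : Var} {A : Ty 1} {Δ : Cx} {u : Tm} (⊢u : Δ ⊩ u ∶ A) (tokens-Δ : Tokens Δ) where

  substitution : Γ ⊩ t ∶ B → Γ ↭ (vr x , A) ∷ Ψ → Fresh x Ψ →
                 (Ψ ++ Δ ⊩ t [ x ≔ u ] ∶ B) × size (t [ x ≔ u ]) ≡ size t + size u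

  substitution-++ : Γ₁ ⊩ s₁ ∶ T₁ → Γ₂ ⊩ s₂ ∶ T₂ → Γ₁ ++ Γ₂ ↭ (vr x , A) ∷ Ψ → Fresh x Ψ →
                    Split (Ψ ++ Δ) (s₁ [ x ≔ u ]) T₁ (s₂ [ x ≔ u ]) T₂ ×
                    size (s₁ [ x ≔ u ]) + size (s₂ [ x ≔ u ]) ≡ size s₁ + size s₂ + size u

  substitution hyp p fx with refl ← ↭.↭-singleton-inv (↭-sym p)
    rewrite lookupTm-hit x u [] = ⊢u , refl
  substitution tok p fx with () ← ↭.↭-singleton-inv (↭-sym p)
  substitution (⊸I fy ⊢t) p fx with y≢x ∷ fy′ ← ↭.All-resp-↭ p fy
    rewrite removeTm-miss {u = u} (≢-sym (≢-vr y≢x)) =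
      Product.map (⊸I (Allₚ.++⁺ fy′ (tokens-fresh tokens-Δ))) (cong suc)
        (substitution ⊢t (↭-trans (prep _ p) (swap _ _ ↭-refl)) (≢-sym y≢x ∷ fx))
  substitution (⊸E ⊢s₁ ⊢s₂) p fx with split q ⊢s₁′ ⊢s₂′ , size≡ ← substitution-++ ⊢s₁ ⊢s₂ p fx =
    perm q (⊸E ⊢s₁′ ⊢s₂′) , cong suc size≡
  substitution (⊗I ⊢s₁ ⊢s₂) p fx with split q ⊢s₁′ ⊢s₂′ , size≡ ← substitution-++ ⊢s₁ ⊢s₂ p fx =
    perm q (⊗I ⊢s₁′ ⊢s₂′) , cong suc size≡
  substitution (⊗E ⊢s ⊢k) p fx with split q ⊢s′ ⊢k′ , size≡ ← substitution-++ ⊢s ⊢k p fx =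
    perm q (⊗E ⊢s′ ⊢k′) , cong suc size≡
  substitution (∀I ⊢t) p fx =
    ∀I (λ C → proj₁ (substitution (⊢t C) p fx)) , proj₂ (substitution (⊢t α) p fx)
  substitution (∀E C ⊢t) p fx = Product.map₁ (∀E C) (substitution ⊢t p fx)
  substitution (perm q ⊢t) p fx = substitution ⊢t (↭-trans q p) fx

  substitution-++ {Γ₁ = Γ₁} {s₁ = s₁} {Γ₂ = Γ₂} {s₂ = s₂} ⊢s₁ ⊢s₂ p fx with ++-↭-∷⁻ Γ₁ p
  ... | inj₁ (Γ₁′ , q , r) with fx′ ← ↭.All-resp-↭ (↭-sym r) fx
    rewrite substTm-fresh ⊢s₂ ((x , u) ∷ []) (Allₚ.++⁻ʳ Γ₁′ fx′ ∷ []) =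
    let ⊢s₁′ , size≡ = substitution ⊢s₁ q (Allₚ.++⁻ˡ Γ₁′ fx′)
    in split (↭-trans (++-↭.xy∙z≈xz∙y Γ₁′ Δ Γ₂) (↭.++⁺ʳ Δ r)) ⊢s₁′ ⊢s₂ ,
       trans (cong (_+ size s₂) size≡) (xy∙z≈xz∙y (size s₁) (size u) (size s₂))
  ... | inj₂ (Γ₂′ , q , r) with fx′ ← ↭.All-resp-↭ (↭-sym r) fx
    rewrite substTm-fresh ⊢s₁ ((x , u) ∷ []) (Allₚ.++⁻ˡ Γ₁ fx′ ∷ []) =
    let ⊢s₂′ , size≡ = substitution ⊢s₂ q (Allₚ.++⁻ʳ Γ₁ fx′)
    in split (↭-trans (↭-sym (↭.++-assoc Γ₁ Γ₂′ Δ)) (↭.++⁺ʳ Δ r)) ⊢s₁ ⊢s₂′ ,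
       trans (cong (size s₁ +_) size≡) (sym (+-assoc (size s₁) (size s₂) (size u)))

-- Preservation and normalisation

data Canonical (Γ : Cx) : Tm → Ty 1 → Set where
  at-α : (tk a , α) ∷ [] ↭ Γ → Canonical Γ (tok a) α
  at-⊸ : Fresh x Γ → (vr x , A) ∷ Γ ⊩ t ∶ B → Canonical Γ (lam x t) (A ⊸ B)
  at-⊗ : Split Γ s₁ A s₂ B → Canonical Γ (pair s₁ s₂) (A ⊗ B)
  at-∀ : ∀ {A} → (∀ C → Canonical Γ v (A [ C ]ᵗ)) → Canonical Γ v (all A)

canonical-resp-↭ : Γ ↭ Δ → Canonical Γ v T → Canonical Δ v T
canonical-resp-↭ p (at-α q)                    = at-α (↭-trans q p)
canonical-resp-↭ p (at-⊸ fx ⊢t)                = at-⊸ (↭.All-resp-↭ p fx) (perm (prep _ p) ⊢t)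
canonical-resp-↭ p (at-⊗ (split q ⊢s₁ ⊢s₂))    = at-⊗ (split (↭-trans q p) ⊢s₁ ⊢s₂)
canonical-resp-↭ p (at-∀ c)                    = at-∀ λ C → canonical-resp-↭ p (c C)

canonical : TmValue v → Γ ⊩ v ∶ T → Canonical Γ v T
canonical _   tok           = at-α ↭-refl
canonical _   (⊸I fx ⊢t)    = at-⊸ fx ⊢t
canonical _   (⊗I ⊢s₁ ⊢s₂)  = at-⊗ (split ↭-refl ⊢s₁ ⊢s₂)
canonical val (∀I ⊢v)       = at-∀ λ C → canonical val (⊢v C)
canonical val (∀E C ⊢v) with at-∀ c ← canonical val ⊢v = c C
canonical val (perm p ⊢v)   = canonical-resp-↭ p (canonical val ⊢v)
canonical () hyp
canonical () (⊸E _ _)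
canonical () (⊗E _ _)

β-lam : Γ ⊩ lam x t ∶ A ⊸ B → Δ ⊩ u ∶ A → Tokens Δ →
        (Γ ++ Δ ⊩ t [ x ≔ u ] ∶ B) × size (t [ x ≔ u ]) ≡ size t + size u
β-lam ⊢f ⊢u ts with at-⊸ fx ⊢t ← canonical (v-lam _ _) ⊢f = substitution ⊢u ts ⊢t ↭-refl fx

β-mtch : TmValue (pair v₁ v₂) → Γ ⊩ pair v₁ v₂ ∶ A ⊗ B → Tokens Γ →
         Δ ⊩ lam x (lam y t) ∶ A ⊸ B ⊸ C →
         (Γ ++ Δ ⊩ substTm ((x , v₁) ∷ (y , v₂) ∷ []) t ∶ C) ×
         size (substTm ((x , v₁) ∷ (y , v₂) ∷ []) t) ≡ size t + size v₁ + size v₂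
β-mtch {v₁ = v₁} {v₂ = v₂} {Δ = Δ} {x = x} {y = y} {t = t} val ⊢p ts ⊢k
  with at-⊗ (split {Γ₁} q ⊢v₁ ⊢v₂) ← canonical val ⊢p
     | at-⊸ fx ⊢λy ← canonical (v-lam _ _) ⊢k
  with at-⊸ (y≢x ∷ fy) ⊢t ← canonical (v-lam _ _) ⊢λy
  with ts₁ , ts₂ ← Allₚ.++⁻ Γ₁ (↭.All-resp-↭ (↭-sym q) ts)
  rewrite substTm-∷ {x = x} (substTm-tokens ⊢v₁ ts₁) ((y , v₂) ∷ []) t =
    let ⊢t₁ , size₁ = substitution ⊢v₁ ts₁ ⊢t (swap _ _ ↭-refl) (≢-sym y≢x ∷ fx)
        ⊢t₂ , size₂ = substitution ⊢v₂ ts₂ ⊢t₁ ↭-refl (Allₚ.++⁺ fy (tokens-fresh ts₁))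
    in perm (↭-trans (++-↭.xy∙z≈yz∙x Δ Γ₁ _) (↭.++⁺ʳ Δ q)) ⊢t₂ ,
       trans size₂ (cong (_+ size v₂) size₁)

preservation : s ⇓ v → Γ ⊩ s ∶ T → Tokens Γ → Γ ⊩ v ∶ T
preservation s⇓v (∀I ⊢s)    ts = ∀I λ C → preservation s⇓v (⊢s C) ts
preservation s⇓v (∀E C ⊢s)  ts = ∀E C (preservation s⇓v ⊢s ts)
preservation s⇓v (perm p ⊢s) ts = perm p (preservation s⇓v ⊢s (↭.All-resp-↭ (↭-sym p) ts))
preservation ev-tok tok ts = tok
preservation ev-lam (⊸I fx ⊢t) ts = ⊸I fx ⊢t
preservation (ev-pair ⇓v₁ ⇓v₂) (⊗I {Γ = Γ} ⊢s₁ ⊢s₂) ts =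
  ⊗I (preservation ⇓v₁ ⊢s₁ (Allₚ.++⁻ˡ Γ ts)) (preservation ⇓v₂ ⊢s₂ (Allₚ.++⁻ʳ Γ ts))
preservation (ev-app ⇓f ⇓u ⇓v) (⊸E {Γ = Γ} ⊢s₁ ⊢s₂) ts
  with ts₁ , ts₂ ← Allₚ.++⁻ Γ ts =
    preservation ⇓v (proj₁ (β-lam (preservation ⇓f ⊢s₁ ts₁) (preservation ⇓u ⊢s₂ ts₂) ts₂)) ts
preservation (ev-mtch ⇓p ⇓v) (⊗E {Γ = Γ} ⊢s ⊢k) ts
  with ts₁ , _ ← Allₚ.++⁻ Γ ts =
    preservation ⇓v (proj₁ (β-mtch (⇓-value ⇓p) (preservation ⇓p ⊢s ts₁) ts₁ ⊢k)) ts

Normalises : Tm → Set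
Normalises s = ∃ λ v → s ⇓ v × size v ≤ size s

Normaliser : ℕ → Set
Normaliser n = ∀ {Γ s T} → size s ≤ n → Γ ⊩ s ∶ T → Tokens Γ → Normalises s

normalises-app : Normaliser n → size s₁ + size s₂ ≤ n →
                 Γ ⊩ s₁ ∶ A ⊸ B → Δ ⊩ s₂ ∶ A → Tokens (Γ ++ Δ) → Normalises (app s₁ s₂)
normalises-app {s₁ = s₁} {Γ = Γ} ih le ⊢s₁ ⊢s₂ ts
  with ts₁ , ts₂ ← Allₚ.++⁻ Γ ts
  with f , s₁⇓f , f≤ ← ih (m+n≤o⇒m≤o (size s₁) le) ⊢s₁ ts₁
  with ⊢f ← preservation s₁⇓f ⊢s₁ ts₁
  with at-⊸ _ _ ← canonical (⇓-value s₁⇓f) ⊢f =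
    let u , s₂⇓u , u≤ = ih (m+n≤o⇒n≤o (size s₁) le) ⊢s₂ ts₂
        ⊢t′ , size≡ = β-lam ⊢f (preservation s₂⇓u ⊢s₂ ts₂) ts₂
        bound = ≤-trans (≤-reflexive size≡) (+-mono-≤ (≤-trans (n≤1+n _) f≤) u≤)
        v , t′⇓v , v≤ = ih (≤-trans bound le) ⊢t′ ts
    in v , ev-app s₁⇓f s₂⇓u t′⇓v , m≤n⇒m≤1+n (≤-trans v≤ bound)

normalises-mtch : Normaliser n → size s + suc (suc (size t)) ≤ n →
                  Γ ⊩ s ∶ A ⊗ B → Δ ⊩ lam x (lam y t) ∶ A ⊸ B ⊸ C → Tokens (Γ ++ Δ) →
                  Normalises (mtch s x y t)
normalises-mtch {s = s} {t = t} {Γ = Γ} ih le ⊢s ⊢k ts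
  with ts₁ , _ ← Allₚ.++⁻ Γ ts
  with p , s⇓p , p≤ ← ih (m+n≤o⇒m≤o (size s) le) ⊢s ts₁
  with ⊢p ← preservation s⇓p ⊢s ts₁
  with at-⊗ {s₁ = v₁} {s₂ = v₂} _ ← canonical (⇓-value s⇓p) ⊢p =
    let ⊢t′ , size≡ = β-mtch (⇓-value s⇓p) ⊢p ts₁ ⊢k
        v , t′⇓v , v≤ = ih (≤-trans (bound size≡) le) ⊢t′ ts
    in v , ev-mtch s⇓p t′⇓v , m≤n⇒m≤1+n (≤-trans v≤ (bound size≡))
  where
    open ≤-Reasoning
    bound : ∀ {m} → m ≡ size t + size v₁ + size v₂ → m ≤ size s + suc (suc (size t))
    bound {m} m≡ = begin
      m                            ≡⟨ m≡ ⟩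
      size t + size v₁ + size v₂   ≡⟨ +-assoc (size t) _ _ ⟩
      size t + (size v₁ + size v₂) ≤⟨ +-mono-≤ (m≤n⇒m≤1+n (n≤1+n _)) (<⇒≤ p≤) ⟩
      suc (suc (size t)) + size s  ≡⟨ +-comm _ (size s) ⟩
      size s + suc (suc (size t))  ∎

normalises : ∀ n → Normaliser n
normalises n le (∀I ⊢s)     ts = normalises n le (⊢s α) ts
normalises n le (∀E _ ⊢s)   ts = normalises n le ⊢s ts
normalises n le (perm p ⊢s) ts = normalises n le ⊢s (↭.All-resp-↭ (↭-sym p) ts)
normalises n le hyp (() ∷ [])
normalises n le tok      _ = _ , ev-tok , ≤-refl
normalises n le (⊸I _ _) _ = _ , ev-lam , ≤-refl
normalises (suc n) (s≤s le) (⊸E ⊢s₁ ⊢s₂) ts = normalises-app (normalises n) le ⊢s₁ ⊢s₂ ts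
normalises (suc n) (s≤s le) (⊗E ⊢s ⊢k)   ts = normalises-mtch (normalises n) le ⊢s ⊢k ts
normalises (suc n) (s≤s le) (⊗I {Γ = Γ} {s₁ = s₁} ⊢s₁ ⊢s₂) ts =
  let v₁ , s₁⇓v₁ , v₁≤ = normalises n (m+n≤o⇒m≤o (size s₁) le) ⊢s₁ (Allₚ.++⁻ˡ Γ ts)
      v₂ , s₂⇓v₂ , v₂≤ = normalises n (m+n≤o⇒n≤o (size s₁) le) ⊢s₂ (Allₚ.++⁻ʳ Γ ts)
  in pair v₁ v₂ , ev-pair s₁⇓v₁ s₂⇓v₂ , s≤s (+-mono-≤ v₁≤ v₂≤)

-- Embedding the linear type system

distinct-resp-↭ : Ω ↭ Ω′ → Distinct Ω → Distinct Ω′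
distinct-resp-↭ p = ↭ₛ.Unique-resp-↭ (≡.setoid Var) (↭⇒↭ₛ (↭.map⁺ proj₁ p))

distinct-∷ʳ : ∀ {p} → Distinct (Ω ∷ʳ p) → Distinct (p ∷ Ω)
distinct-∷ʳ {Ω = Ω} = distinct-resp-↭ (↭-sym (↭.∷↭∷ʳ _ Ω))

keys-wkCtx : ∀ (Ω : Ctx n) → map proj₁ (wkCtx Ω) ≡ map proj₁ Ω
keys-wkCtx []      = refl
keys-wkCtx (_ ∷ Ω) = cong (_ ∷_) (keys-wkCtx Ω)

⊢-distinct : Ω ⊢ e ∶ D → Distinct Ω
⊢-distinct hyp                = [] ∷ []
⊢-distinct (⊸I ⊢e) with _ ∷ distinct ← distinct-∷ʳ (⊢-distinct ⊢e) = distinct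
⊢-distinct (⊸E distinct _ _)  = distinct
⊢-distinct (⊗I distinct _ _)  = distinct
⊢-distinct (⊗E distinct _ _)  = distinct
⊢-distinct (∀I {Ω} ⊢e)        = ≡.subst Unique (keys-wkCtx Ω) (⊢-distinct ⊢e)
⊢-distinct (∀E _ ⊢e)          = ⊢-distinct ⊢e
⊢-distinct (exch {ΩL} ⊢e)     = distinct-resp-↭ (↭.++⁺ˡ ΩL (swap _ _ ↭-refl)) (⊢-distinct ⊢e)

embedCx : (Fin n → Ty 1) → Ctx n → Cx
embedCx σ = map λ (x , D) → vr x , tsub σ D

fresh-embedCx : ∀ {σ : Fin n → Ty 1} → All (x ≢_) (map proj₁ Ω) → Fresh x (embedCx σ Ω)
fresh-embedCx {Ω = []}    []           = []
fresh-embedCx {Ω = _ ∷ _} (x≢y ∷ x∉Ω) = vr-≢ x≢y ∷ fresh-embedCx x∉Ω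

embedCx-wk : ∀ (C : Ty 1) σ (Ω : Ctx n) → embedCx (C ∷ᵛ σ) (wkCtx Ω) ≡ embedCx σ Ω
embedCx-wk C σ []            = refl
embedCx-wk C σ ((x , D) ∷ Ω) =
  cong₂ _∷_ (cong (vr x ,_) (tsub-ren (λ _ → refl) D)) (embedCx-wk C σ Ω)

⊢⇒⊩ : (σ : Fin n → Ty 1) → Ω ⊢ e ∶ D → embedCx σ Ω ⊩ embed e ∶ tsub σ D
⊢⇒⊩ σ hyp = hyp
⊢⇒⊩ σ (⊸I {Ω} ⊢e) with x∉Ω ∷ _ ← distinct-∷ʳ (⊢-distinct ⊢e) =
  ⊸I (fresh-embedCx x∉Ω) (perm (↭.map⁺ _ (↭-sym (↭.∷↭∷ʳ _ Ω))) (⊢⇒⊩ σ ⊢e))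
⊢⇒⊩ σ (⊸E {Ω} {ΩA} _ ⊢e₁ ⊢e₂) =
  ≡.subst (_⊩ _ ∶ _) (sym (List.map-++ _ Ω ΩA)) (⊸E (⊢⇒⊩ σ ⊢e₁) (⊢⇒⊩ σ ⊢e₂))
⊢⇒⊩ σ (⊗I {ΩA} {ΩB} _ ⊢e₁ ⊢e₂) =
  ≡.subst (_⊩ _ ∶ _) (sym (List.map-++ _ ΩA ΩB)) (⊗I (⊢⇒⊩ σ ⊢e₁) (⊢⇒⊩ σ ⊢e₂))
⊢⇒⊩ σ (⊗E {Ω} {ΩL} {ΩR} {x = x} {y = y} {A = A} {B = B} _ ⊢e ⊢e′)
  with xy-front ← ↭.shifts ΩL ((x , A) ∷ (y , B) ∷ []) {ΩR}
  with (x≢y ∷ x∉) ∷ y∉ ∷ _ ← distinct-resp-↭ xy-front (⊢-distinct ⊢e′) =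
    perm (↭-trans (↭-reflexive (sym (List.map-++ _ Ω (ΩL ++ ΩR)))) (↭.map⁺ _ (↭.shifts Ω ΩL)))
      (⊗E (⊢⇒⊩ σ ⊢e)
          (curry-⊩ x≢y (fresh-embedCx x∉) (fresh-embedCx y∉)
            (perm (↭.map⁺ _ xy-front) (⊢⇒⊩ σ ⊢e′))))
⊢⇒⊩ σ (∀I {Ω} {A = D} ⊢e) =
  ∀I λ C → ≡.subst₂ (_⊩ _ ∶_) (embedCx-wk C σ Ω) (sym (inst-exts C σ D)) (⊢⇒⊩ (C ∷ᵛ σ) ⊢e)
⊢⇒⊩ σ (∀E {A = D} B ⊢e) =
  ≡.subst (_ ⊩ _ ∶_) (trans (inst-exts (tsub σ B) σ D) (sym (tsub-inst σ B D)))
    (∀E (tsub σ B) (⊢⇒⊩ σ ⊢e))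
⊢⇒⊩ σ (exch {ΩL} ⊢e) = perm (↭.map⁺ _ (↭.++⁺ˡ ΩL (swap _ _ ↭-refl))) (⊢⇒⊩ σ ⊢e)

-- Running e on two tokens

Γ₀ : Cx
Γ₀ = (tk true , α) ∷ (tk false , α) ∷ []

tokens-Γ₀ : Tokens Γ₀
tokens-Γ₀ = _ ∷ _ ∷ []

tokenRun : Exp → Tm
tokenRun e = app (app (embed e) (tok true)) (tok false)

⊩-tokenRun : ⊢₀ e ∶ swapTy → Γ₀ ⊩ tokenRun e ∶ α ⊗ α
⊩-tokenRun ⊢e = ⊸E (⊸E (∀E α (⊢⇒⊩ (λ ()) ⊢e)) tok) tok

tokens-pair : TmValue v → Γ ⊩ v ∶ α ⊗ α →
              ∃₂ λ a b → v ≡ pair (tok a) (tok b) × (tk a , α) ∷ (tk b , α) ∷ [] ↭ Γ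
tokens-pair (v-pair val₁ val₂) ⊢v
  with at-⊗ (split q ⊢v₁ ⊢v₂) ← canonical (v-pair val₁ val₂) ⊢v
  with at-α q₁ ← canonical val₁ ⊢v₁
  with at-α q₂ ← canonical val₂ ⊢v₂ = _ , _ , refl , ↭-trans (↭.++⁺ q₁ q₂) q
tokens-pair (v-tok _)   ⊢v with () ← canonical (v-tok _) ⊢v
tokens-pair (v-lam _ _) ⊢v with () ← canonical (v-lam _ _) ⊢v

two-tokens : ∀ a b → (tk a , α) ∷ (tk b , α) ∷ [] ↭ Γ₀ → b ≡ not a
two-tokens true  false _ = refl
two-tokens false true  _ = refl
two-tokens true  true  q with ↭.∈-resp-↭ (↭-sym q) (there (here refl))
... | here ()
... | there (here ())
two-tokens false false q with ↭.∈-resp-↭ (↭-sym q) (here refl)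
... | here ()
... | there (here ())

tokenRun-⇓ : ⊢₀ e ∶ swapTy → ∃ λ a → tokenRun e ⇓ pair (tok a) (tok (not a))
tokenRun-⇓ ⊢e
  with v , run⇓v , _ ← normalises _ ≤-refl (⊩-tokenRun ⊢e) tokens-Γ₀
  with a , b , refl , q ← tokens-pair (⇓-value run⇓v) (preservation run⇓v (⊩-tokenRun ⊢e) tokens-Γ₀)
  with refl ← two-tokens a b q = a , run⇓v

slot : Bool → Var
slot a = if a then 0 else 1

-- pairing true false and pairing false true are, definitionally, idPair and swPair.
pairing : Bool → Bool → Exp
pairing a b = lam 0 (lam 1 (pair (var (slot a)) (var (slot b))))

pairing-↪ : ∀ {v w} a b → Value v → Closed v → Value w →
            app (app (pairing a b) v) w ↪ pair (if a then v else w) (if b then v else w)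
pairing-↪ {v} {w} a b val-v cl-v val-w =
  ev-app (ev-app ev-lam (value-↪ val-v) ev-lam) (value-↪ val-w) (ev-pair (slot-↪ a) (slot-↪ b))
  where
    slot-↪ : ∀ a → subst ((1 , w) ∷ []) (lookupSub ((0 , v) ∷ []) (slot a)) ↪ (if a then v else w)
    slot-↪ true  = ≡.subst (_↪ v) (sym (subst-closed₀ cl-v _)) (value-↪ val-v)
    slot-↪ false = value-↪ val-w

extEq-pairing : tokenRun e ⇓ pair (tok a) (tok b) → ExtEq e (pairing a b)
extEq-pairing {e} {a} {b} run⇓ v w val-v cl-v val-w cl-w =
  pair (choose a) (choose b) ,
  ≡.subst (λ e′ → app (app e′ v) w ↪ pair (choose a) (choose b)) (fill-embed e) (fill-⇓ run⇓) ,
  pairing-↪ a b val-v cl-v val-w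
  where
    choose : Bool → Exp
    choose a = if a then v else w

    choose-closed : ∀ a → Closed (choose a)
    choose-closed true  = cl-v
    choose-closed false = cl-w

    choose-value : ∀ a → Value (choose a)
    choose-value true  = val-v
    choose-value false = val-w

    open Filling choose choose-closed choose-value

mainTheorem12 : (e : Exp) → ⊢₀ e ∶ swapTy → ExtEq e idPair ⊎ ExtEq e swPair
mainTheorem12 e ⊢e with tokenRun-⇓ ⊢e
... | true  , run⇓ = inj₁ (extEq-pairing run⇓)
... | false , run⇓ = inj₂ (extEq-pairing run⇓)
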